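{- Let $\rho$ be a strict $n$-metric. Then no directed graph on $[n]$ that is admissible for $\rho$ contains a directed path with more than $2$ vertices.
   Context: An $n$-metric is a real symmetric $n\times n$ matrix $\rho=(\rho_{ij})$ with $\rho_{ii}=0$, $\rho_{ij}>0$ for $i\neq j$, and $\rho_{ij}+\rho_{jk}\ge\rho_{ik}$ for all $i,j,k$. It is strict if $\rho_{ij}+\rho_{jk}>\rho_{ik}$ for all $i,k$ and all $j\in[n]\setminus\{i,k\}$. A directed graph $G$ (without loops) on $[n]$ is called admissible for $\rho$ if for every $k\ge1$ and every family of directed edges $(x_i,y_i)$, $1\le i\le k$, of $G$ with the $x_i$ pairwise distinct and the $y_i$ pairwise distinct, one has $\sum_{i=1}^k\rho_{x_iy_i}\le\sum_{i=1}^k\rho_{x_iy_{i+1}}$, where $y_{k+1}=y_1$. -}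

module Defs where

open import Level using (Level; _⊔_) renaming (suc to lsuc)
open import Data.Nat as ℕ using (ℕ; zero; suc)
open import Data.Nat.DivMod using (_%_; m%n<n)
open import Data.Fin using (Fin; zero; suc; toℕ; fromℕ<)
open import Data.Product using (Σ; _×_)
open import Relation.Nullary using (¬_)
open import Relation.Binary.Core using (Rel)
open import Relation.Binary.Structures using (IsTotalOrder)
open import Relation.Binary.PropositionalEquality using (_≡_; _≢_)
open import Function.Definitions using (Injective)
open import Algebra.Bundles using (AbelianGroup)

-- The paper's metrics are real valued.  Agda's stdlib has no reals, so we
-- state the result for an arbitrary totally ordered abelian group
-- (written with the stdlib's  _∙_ / ε ;  (ℝ, +, 0, ≤) is an instance).
record OrderedAbelianGroup (c ℓ₁ ℓ₂ : Level) : Set (lsuc (c ⊔ ℓ₁ ⊔ ℓ₂)) where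
  field
    abelianGroup : AbelianGroup c ℓ₁
  open AbelianGroup abelianGroup public
  field
    _≤_          : Rel Carrier ℓ₂
    isTotalOrder : IsTotalOrder _≈_ _≤_
    ∙-monoˡ-≤    : ∀ {a b} (d : Carrier) → a ≤ b → (a ∙ d) ≤ (b ∙ d)

  _<_ : Rel Carrier (ℓ₁ ⊔ ℓ₂)
  a < b = (a ≤ b) × ¬ (a ≈ b)

next : ∀ {m} → Fin (suc m) → Fin (suc m)
next {m} i = fromℕ< (m%n<n (suc (toℕ i)) (suc m))

module _ {c ℓ₁ ℓ₂} (R : OrderedAbelianGroup c ℓ₁ ℓ₂) where
  open OrderedAbelianGroup R

  sumFin : ∀ k → (Fin k → Carrier) → Carrier
  sumFin zero    f = ε
  sumFin (suc k) f = f zero ∙ sumFin k (λ i → f (suc i))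

  IsMetric : ∀ n → (Fin n → Fin n → Carrier) → Set (ℓ₁ ⊔ ℓ₂)
  IsMetric n ρ =
    (∀ i j → ρ i j ≈ ρ j i) ×
    (∀ i → ρ i i ≈ ε) ×
    (∀ i j → i ≢ j → ε < ρ i j) ×
    (∀ i j k → ρ i k ≤ (ρ i j ∙ ρ j k))

  IsStrictMetric : ∀ n → (Fin n → Fin n → Carrier) → Set (ℓ₁ ⊔ ℓ₂)
  IsStrictMetric n ρ =
    IsMetric n ρ ×
    (∀ i j k → j ≢ i → j ≢ k → ρ i k < (ρ i j ∙ ρ j k))

  -- G (edge relation on [n]) is admissible for ρ.  A family of k ≥ 1 edges is
  -- indexed by Fin (suc m) (k = suc m); y_{i+1} with y_{k+1} = y_1 is  y (next i).
  Admissible : ∀ n → (Fin n → Fin n → Carrier) → (Fin n → Fin n → Set) → Set ℓ₂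
  Admissible n ρ G =
    ∀ (m : ℕ) (x y : Fin (suc m) → Fin n) →
    Injective _≡_ _≡_ x → Injective _≡_ _≡_ y →
    (∀ i → G (x i) (y i)) →
    sumFin (suc m) (λ i → ρ (x i) (y i)) ≤ sumFin (suc m) (λ i → ρ (x i) (y (next i)))

NoLoops : ∀ {n} → (Fin n → Fin n → Set) → Set
NoLoops G = ∀ i → ¬ G i i

DirectedPath : ∀ {n} → (Fin n → Fin n → Set) → ℕ → Set
DirectedPath {n} G m =
  Σ (Fin m → Fin n) λ v →
    Injective _≡_ _≡_ v ×
    (∀ (i j : Fin m) → toℕ j ≡ suc (toℕ i) → G (v i) (v j))

{-# OPTIONS --safe #-}
module Submission where

-- Admissibility, applied to two consecutive edges a → b → c viewed as the
-- family x = (a , b), y = (b , c), reverses the triangle inequality: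
-- ρ a b + ρ b c ≤ ρ a c + ρ b b = ρ a c, which a strict metric forbids.

open import Defs
open import Level using (Level)
open import Data.Nat using (ℕ; _>_; suc; s≤s)
open import Data.Fin using (Fin; zero; suc)
open import Data.Fin.Properties using (0≢1+n; suc-injective)
open import Data.Product using (_,_)
open import Data.Empty using (⊥)
open import Function using (_∘_)
open import Function.Definitions using (Injective)
open import Function.Consequences.Propositional using (contraInjective)
open import Relation.Nullary using (¬_; contradiction)
open import Relation.Binary.PropositionalEquality as ≡ using (_≡_; _≢_; refl)
open import Relation.Binary.Structures using (IsTotalOrder)

pair : ∀ {a} {A : Set a} → A → A → Fin 2 → A
pair x y zero       = x
pair x y (suc zero) = y

pair-injective : ∀ {a} {A : Set a} {x y : A} → x ≢ y → Injective _≡_ _≡_ (pair x y)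
pair-injective _   {zero}     {zero}     _ = refl
pair-injective x≢y {zero}     {suc zero} e = contradiction e x≢y
pair-injective x≢y {suc zero} {zero}     e = contradiction (≡.sym e) x≢y
pair-injective _   {suc zero} {suc zero} _ = refl

module _ {c ℓ₁ ℓ₂} (R : OrderedAbelianGroup c ℓ₁ ℓ₂) where
  open OrderedAbelianGroup R
  open IsTotalOrder isTotalOrder using (antisym; ≲-respˡ-≈; ≲-respʳ-≈)

  <⇒≱ : ∀ {a b} → a < b → ¬ (b ≤ a)
  <⇒≱ (a≤b , a≉b) b≤a = a≉b (antisym a≤b b≤a)

  sumFin-two : ∀ f → sumFin R 2 f ≈ (f zero ∙ f (suc zero))
  sumFin-two f = ∙-congˡ (identityʳ _)

  module _ {n} {ρ : Fin n → Fin n → Carrier} {G : Fin n → Fin n → Set} where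

    admissible⇒two-edges-bound : Admissible R n ρ G →
      ∀ {a b c} → a ≢ b → b ≢ c → G a b → G b c → (ρ a b ∙ ρ b c) ≤ (ρ a c ∙ ρ b b)
    admissible⇒two-edges-bound adm {a} {b} {c} a≢b b≢c ab bc =
      ≲-respˡ-≈ (sumFin-two (λ i → ρ (x i) (y i)))
        (≲-respʳ-≈ (sumFin-two (λ i → ρ (x i) (y (next i))))
          (adm 1 x y (pair-injective a≢b) (pair-injective b≢c) edges))
      where
      x y : Fin 2 → Fin n
      x = pair a b
      y = pair b c

      edges : ∀ i → G (x i) (y i)
      edges zero       = ab
      edges (suc zero) = bc

    strict-admissible⇒¬two-edges : IsStrictMetric R n ρ → Admissible R n ρ G →
      ∀ {a b c} → a ≢ b → b ≢ c → G a b → G b c → ⊥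
    strict-admissible⇒¬two-edges ((_ , ρ-diag , _ , _) , ρ-strict) adm {a} {b} {c}
                                 a≢b b≢c ab bc =
      <⇒≱ (ρ-strict a b c (a≢b ∘ ≡.sym) b≢c)
          (≲-respʳ-≈ ρac∙ρbb≈ρac (admissible⇒two-edges-bound adm a≢b b≢c ab bc))
      where
      ρac∙ρbb≈ρac : (ρ a c ∙ ρ b b) ≈ ρ a c
      ρac∙ρbb≈ρac = trans (∙-congˡ (ρ-diag b)) (identityʳ _)

corollary2p8 : ∀ {c ℓ₁ ℓ₂ : Level} (R : OrderedAbelianGroup c ℓ₁ ℓ₂) (n : ℕ)
    (ρ : Fin n → Fin n → OrderedAbelianGroup.Carrier R) →
    IsStrictMetric R n ρ →
    (G : Fin n → Fin n → Set) → NoLoops G → Admissible R n ρ G →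
    ∀ (m : ℕ) → m > 2 → ¬ DirectedPath G m
corollary2p8 R n ρ strict G _ adm (suc (suc (suc _))) (s≤s (s≤s (s≤s _)))
             (v , v-injective , v-edges) =
  strict-admissible⇒¬two-edges R {G = G} strict adm
    (v≢ 0≢1+n) (v≢ (0≢1+n ∘ suc-injective))
    (v-edges zero (suc zero) refl) (v-edges (suc zero) (suc (suc zero)) refl)
  where
  v≢ : ∀ {i j} → i ≢ j → v i ≢ v j
  v≢ = contraInjective v-injective
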